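{- Let $T\in\{0,1\}^n$ be a nonempty text and $\mathcal{D}=\{P_1,\dots,P_k\}\subseteq\{0,1\}^m$ a set of $k\ge0$ distinct patterns of common length $m\ge3$. For $i\in[1\mathinner{.\,.}k]$ let $P'_i\in\{2,3\}^m$ be obtained from $P_i$ by replacing every $0$ with $2$ and every $1$ with $3$, and let $P_{k+1}=0^m$. Over the alphabet $\{0,1,\dots,6\}$ define $S=S_1S_2S_3$ with $S_1=T\cdot 5$, $S_2=\Big(\prod_{i=1}^{k} P_i(1\mathinner{.\,.}m]\cdot 4\cdot P_i[1\mathinner{.\,.}m)\cdot 4\cdot P_i[m]\cdot P'_i\cdot 4\cdot P'_i\cdot P_{i+1}[1]\cdot 4\Big)\cdot 6$, $S_3=\Big(\prod_{i=1}^{k} P_i\cdot P'_i\Big)\cdot P_{k+1}[1]$, where $\prod$ denotes concatenation in order of increasing $i$. If there exists $i\in[1\mathinner{.\,.}k]$ such that $P_i$ occurs in $T$, then $z(S)-z(S_1S_2)=z_{\rm no}(S)-z_{\rm no}(S_1S_2)=2k$. Otherwise, $z(S)-z(S_1S_2)=z_{\rm no}(S)-z_{\rm no}(S_1S_2)=2k+1$.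
   Context: For a string $X$ of length $n$ and $i\in[1\mathinner{.\,.}n]$, $\mathrm{LPF}_X[i]$ is the largest $\ell\ge0$ such that $X[j\mathinner{.\,.}j+\ell)=X[i\mathinner{.\,.}i+\ell)$ for some $j<i$; $\mathrm{LPnF}_X[i]$ is defined the same way with the extra requirement $j+\ell\le i$. The LZ77 factorization of $X$ is $X=f_1\cdots f_z$ where, if $f_1\cdots f_{t-1}=X[1\mathinner{.\,.}p)$, then $|f_t|=\max(1,\mathrm{LPF}_X[p])$; $z(X)$ is the number of phrases. $z_{\rm no}(X)$ is the number of phrases of the analogous factorization using $\mathrm{LPnF}_X$. Notation: $X[a\mathinner{.\,.}b)$, $X(a\mathinner{.\,.}b]$ denote substrings excluding the indicated endpoint. -}

module Defs where

open import Data.Nat using (ℕ; zero; suc; _+_; _∸_; _⊔_; _⊓_; _<?_)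
open import Data.List using (List; []; _∷_; _++_; length; map; drop)
open import Data.Product using (∃₂; _×_)
open import Relation.Nullary using (yes; no)
open import Relation.Binary.PropositionalEquality using (_≡_)

-- Strings are lists of natural numbers (letters); positions are 0-indexed here
-- (position p here = position p+1 in the paper).

lcp : List ℕ → List ℕ → ℕ
lcp [] _ = 0
lcp (_ ∷ _) [] = 0
lcp (a ∷ xs) (b ∷ ys) with a Data.Nat.≟ b
... | yes _ = suc (lcp xs ys)
... | no _ = 0

maxBelow : (ℕ → ℕ) → ℕ → ℕ
maxBelow f zero = 0
maxBelow f (suc i) = maxBelow f i ⊔ f i

LPF : List ℕ → ℕ → ℕ
LPF X i = maxBelow (λ j → lcp (drop j X) (drop i X)) i

-- LPnF_X[i]: same with the extra requirement j + ℓ ≤ i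
-- (the set of valid ℓ for a fixed j is downward closed, so the max for j is min(lcp, i - j))
LPnF : List ℕ → ℕ → ℕ
LPnF X i = maxBelow (λ j → lcp (drop j X) (drop i X) ⊓ (i ∸ j)) i

-- number of phrases of the greedy factorization of X starting at position p,
-- where the phrase at p has length max(1, L p); fuel bounds the recursion
phrasesFrom : (L : ℕ → ℕ) → ℕ → ℕ → ℕ → ℕ
phrasesFrom L n zero p = 0
phrasesFrom L n (suc fuel) p with p <? n
... | yes _ = suc (phrasesFrom L n fuel (p + (1 ⊔ L p)))
... | no _ = 0

-- z(X): number of LZ77 phrases (each phrase has length ≥ 1, so |X| fuel suffices)
z : List ℕ → ℕ
z X = phrasesFrom (LPF X) (length X) (length X) 0

zno : List ℕ → ℕ
zno X = phrasesFrom (LPnF X) (length X) (length X) 0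

Occurs : List ℕ → List ℕ → Set
Occurs P T = ∃₂ λ u v → T ≡ u ++ P ++ v

-- first letter (default 0; only used on strings of length ≥ 3)
firstD : List ℕ → ℕ
firstD [] = 0
firstD (a ∷ _) = a

lastD : List ℕ → ℕ
lastD [] = 0
lastD (a ∷ []) = a
lastD (_ ∷ b ∷ xs) = lastD (b ∷ xs)

tailD : List ℕ → List ℕ
tailD [] = []
tailD (_ ∷ xs) = xs

initD : List ℕ → List ℕ
initD [] = []
initD (_ ∷ []) = []
initD (a ∷ b ∷ xs) = a ∷ initD (b ∷ xs)

prime : List ℕ → List ℕ
prime P = map (2 +_) P

-- first letter of the next pattern, where P_{k+1} = 0^m has first letter 0
nextFirst : List (List ℕ) → ℕ
nextFirst [] = 0
nextFirst (Q ∷ _) = firstD Q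

S2body : List (List ℕ) → List ℕ
S2body [] = []
S2body (P ∷ rest) =
  tailD P ++ 4 ∷ initD P ++ 4 ∷ lastD P ∷ prime P ++ 4 ∷ prime P ++ nextFirst rest ∷ 4 ∷ []
  ++ S2body rest

S1 : List ℕ → List ℕ
S1 T = T ++ 5 ∷ []

S2 : List (List ℕ) → List ℕ
S2 D = S2body D ++ 6 ∷ []

S3body : List (List ℕ) → List ℕ
S3body [] = []
S3body (P ∷ rest) = P ++ prime P ++ S3body rest

S3 : List (List ℕ) → List ℕ
S3 D = S3body D ++ 0 ∷ []

{-# OPTIONS --safe #-}
module Submission where

open import Defs
open import Data.Nat using (ℕ; zero; suc; _+_; _*_; _∸_; _⊔_; _⊓_; _<_; _≤_; z≤n; s≤s; z<s; s≤s⁻¹)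
open import Data.Nat.Properties
open import Data.Nat.Tactic.RingSolver using (solve-∀)
open import Data.List using (List; []; _∷_; _++_; length; drop; take)
open import Data.List.Properties
  using ( length-++; length-drop; length-map; ++-assoc; ++-identityʳ; ∷-injective; ∷-injectiveˡ; ∷-injectiveʳ
        ; take++drop≡id; map-injective )
open import Data.List.Relation.Unary.All using (All; []; _∷_)
import Data.List.Relation.Unary.All as All
open import Data.List.Relation.Unary.All.Properties using (++⁺; ++⁻ˡ; ++⁻ʳ; drop⁺)
open import Data.List.Relation.Unary.AllPairs using (_∷_)
open import Data.List.Relation.Unary.Any using (Any; here; there)
open import Data.List.Relation.Unary.Unique.Propositional using (Unique)
open import Data.Product using (_×_; _,_; ∃; proj₁; proj₂)
open import Data.Sum using (_⊎_; inj₁; inj₂)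
open import Data.Unit using (⊤; tt)
open import Function using (_∘_)
open import Relation.Binary.Definitions using (tri<; tri≈; tri>)
open import Relation.Binary.PropositionalEquality
open import Relation.Nullary using (¬_; Dec; yes; no; contradiction)
open import Relation.Nullary.Decidable using (decidable-stable; ¬¬-excluded-middle)

-- The letter 6 occurs only once, right after S1S2, so no phrase starting in S1S2 reaches past it: the
-- factorizations of S1S2·6 and of S agree up to there, and it remains to count the phrases of S that
-- start in S3.  S3 is read block by block, the block of P being P P′.  Apart from a final single letter,
-- every such phrase is a factor of T or of S2 with a copy lying entirely to its left, so its length is
-- both LPF and LPnF; it is maximal because the phrase extended by one letter occurs nowhere earlier:
-- the separators 4, 5, 6 confine that word to a single piece of T or S2, binary letters {0,1} never
-- match primed ones {2,3}, and distinct patterns have distinct blocks.  If P occurs in T, the phrases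
-- from the start of its block are P (copied from T) and P′·Pₙₑₓₜ[1], which moves the parse one letter
-- into the next block; from there each block costs the two phrases P(1..m] and P′·Pₙₑₓₜ[1].  If P does
-- not occur in T, the phrases are P[1..m) and P[m]·P′ and the parse stays at block starts, so that the
-- final letter 0 is a phrase of its own.

private variable
  a b c i j k n p t x y ℓ : ℕ
  s V W X Y : List ℕ
  L L′ : ℕ → ℕ

infix 4 _⊑_
_⊑_ : List ℕ → List ℕ → Set
W ⊑ s = ∃ λ r → s ≡ W ++ r

length-∷ʳ : ∀ X → length (X ++ x ∷ []) ≡ suc (length X)
length-∷ʳ X = trans (length-++ X) (+-comm _ 1)

⊑-length : W ⊑ s → length W ≤ length s
⊑-length {W} (r , refl) = subst (length W ≤_) (sym (length-++ W)) (m≤m+n _ _)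

⊑-drop-length : ∀ t s → W ⊑ drop t s → length W ≤ length s
⊑-drop-length t s W⊑ = ≤-trans (⊑-length W⊑) (≤-trans (≤-reflexive (length-drop t s)) (m∸n≤m _ t))

⊑-All : ∀ {P : ℕ → Set} → All P s → W ⊑ s → All P W
⊑-All Ps (r , refl) = ++⁻ˡ _ Ps

++-⊑-++ : ∀ W {W′} X {Y} → W ++ W′ ⊑ X ++ Y → length W ≡ length X → W ≡ X × W′ ⊑ Y
++-⊑-++ [] [] (r , eq) _ = refl , r , eq
++-⊑-++ (w ∷ W) (x ∷ X) (r , eq) |W|≡|X| with ∷-injective eq
... | refl , eq′ with ++-⊑-++ W X (r , eq′) (suc-injective |W|≡|X|)
...   | refl , W′⊑Y = refl , W′⊑Y

⊑-++⇒≡ : ∀ W X {Y} → W ⊑ X ++ Y → length W ≡ length X → W ≡ X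
⊑-++⇒≡ W X {Y} W⊑ |W|≡|X| = proj₁ (++-⊑-++ W X (subst (_⊑ X ++ Y) (sym (++-identityʳ W)) W⊑) |W|≡|X|)

⊑-drop-∷ : ∀ j s → a ∷ W ⊑ drop j s → W ⊑ drop (suc j) s
⊑-drop-∷ zero (x ∷ s) (r , eq) = r , ∷-injectiveʳ eq
⊑-drop-∷ (suc j) (x ∷ s) W⊑ = ⊑-drop-∷ j s W⊑

⊑-before-separator : ∀ v → All (_< c) W → W ⊑ v ++ c ∷ s → W ⊑ v
⊑-before-separator {W = []} v _ _ = v , refl
⊑-before-separator {W = w ∷ W} [] (w<c ∷ _) (r , eq) = contradiction (∷-injectiveˡ eq) (<⇒≢ w<c ∘ sym)
⊑-before-separator {W = w ∷ W} (x ∷ v) (_ ∷ W<c) (r , eq) with ∷-injective eq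
... | refl , eq′ with ⊑-before-separator v W<c (r , eq′)
...   | r′ , refl = r′ , refl

drop-++ : ∀ j (X Y : List ℕ) → j ≤ length X → drop j (X ++ Y) ≡ drop j X ++ Y
drop-++ zero X Y _ = refl
drop-++ (suc j) (x ∷ X) Y (s≤s j≤) = drop-++ j X Y j≤

drop-length-++ : ∀ (X Y : List ℕ) → drop (length X) (X ++ Y) ≡ Y
drop-length-++ [] Y = refl
drop-length-++ (x ∷ X) Y = drop-length-++ X Y

occurs-++ˡ : Occurs W X → Occurs W (X ++ Y)
occurs-++ˡ {W} {Y = Y} (U , V , refl) = U , V ++ Y , trans (++-assoc U (W ++ V) Y) (cong (U ++_) (++-assoc W V Y))

occurs-++ʳ : ∀ X → Occurs W Y → Occurs W (X ++ Y)
occurs-++ʳ {W} X (U , V , refl) = X ++ U , V , sym (++-assoc X U (W ++ V))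

⊑-drop⇒occurs : ∀ t s → W ⊑ drop t s → Occurs W s
⊑-drop⇒occurs t s (r , eq) = take t s , r , trans (sym (take++drop≡id t s)) (cong (take t s ++_) eq)

lcp-++ : ∀ W (a b : List ℕ) → length W ≤ lcp (W ++ a) (W ++ b)
lcp-++ [] a b = z≤n
lcp-++ (x ∷ W) a b with x ≟ x
... | yes _ = s≤s (lcp-++ W a b)
... | no x≢x = contradiction refl x≢x

lcp⇒⊑ : ∀ W V s → length W ≤ lcp s (W ++ V) → W ⊑ s
lcp⇒⊑ [] V s _ = s , refl
lcp⇒⊑ (x ∷ W) V (a ∷ s) h with a ≟ x
lcp⇒⊑ (x ∷ W) V (a ∷ s) h | yes refl with lcp⇒⊑ W V s (s≤s⁻¹ h)
... | r , refl = r , refl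

lcp≤length : ∀ s v → lcp s v ≤ length v
lcp≤length [] v = z≤n
lcp≤length (x ∷ s) [] = z≤n
lcp≤length (x ∷ s) (b ∷ v) with x ≟ b
... | yes _ = s≤s (lcp≤length s v)
... | no _ = z≤n

maxBelow-least : ∀ f i → (∀ j → j < i → f j ≤ b) → maxBelow f i ≤ b
maxBelow-least f zero h = z≤n
maxBelow-least f (suc i) h = ⊔-lub (maxBelow-least f i (λ j j<i → h j (m≤n⇒m≤1+n j<i))) (h i ≤-refl)

≤-maxBelow : ∀ f i → j < i → f j ≤ maxBelow f i
≤-maxBelow {j} f (suc i) j<1+i with m<1+n⇒m<n∨m≡n j<1+i
... | inj₁ j<i = ≤-trans (≤-maxBelow f i j<i) (m≤m⊔n (maxBelow f i) (f i))
... | inj₂ refl = m≤n⊔m (maxBelow f i) (f i)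

maxBelow-cong : ∀ f g i → (∀ j → j < i → f j ≡ g j) → maxBelow f i ≡ maxBelow g i
maxBelow-cong f g zero h = refl
maxBelow-cong f g (suc i) h = cong₂ _⊔_ (maxBelow-cong f g i (λ j j<i → h j (m≤n⇒m≤1+n j<i))) (h i ≤-refl)

phrases : (ℕ → ℕ) → ℕ → ℕ → ℕ
phrases L n p = phrasesFrom L n n p

<-jump : ∀ p x → p < p + (1 ⊔ x)
<-jump p x = ≤-trans (≤-reflexive (+-comm 1 p)) (+-monoʳ-≤ p (m≤m⊔n 1 x))

∸-jump : ∀ n p x → n ∸ p ≤ suc ℓ → n ∸ (p + (1 ⊔ x)) ≤ ℓ
∸-jump {ℓ} n p x h = ≤-trans (∸-monoʳ-≤ n (<-jump p x)) (subst (_≤ ℓ) (pred[m∸n]≡m∸[1+n] n p) (pred-mono-≤ h))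

phrasesFrom-done : ∀ fuel → n ≤ p → phrasesFrom L n fuel p ≡ 0
phrasesFrom-done zero _ = refl
phrasesFrom-done {n} {p} (suc fuel) n≤p with p <? n
... | yes p<n = contradiction p<n (≤⇒≯ n≤p)
... | no _ = refl

phrasesFrom-fuel : ∀ f g → n ∸ p ≤ f → n ∸ p ≤ g → phrasesFrom L n f p ≡ phrasesFrom L n g p
phrasesFrom-fuel zero g hf _ = sym (phrasesFrom-done g (m∸n≡0⇒m≤n (n≤0⇒n≡0 hf)))
phrasesFrom-fuel (suc f) zero _ hg = phrasesFrom-done (suc f) (m∸n≡0⇒m≤n (n≤0⇒n≡0 hg))
phrasesFrom-fuel {n} {p} {L} (suc f) (suc g) hf hg with p <? n
... | yes _ = cong suc (phrasesFrom-fuel f g (∸-jump n p (L p) hf) (∸-jump n p (L p) hg))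
... | no _ = refl

phrases-step : p < n → phrases L n p ≡ suc (phrases L n (p + (1 ⊔ L p)))
phrases-step {p} {suc n} {L} p<n with p <? suc n
... | yes _ = cong suc (phrasesFrom-fuel n (suc n) (∸-jump (suc n) p (L p) (m∸n≤m (suc n) p))
                                                   (m∸n≤m (suc n) (p + (1 ⊔ L p))))
... | no p≮n = contradiction p<n p≮n

phrases-end : n ≤ p → phrases L n p ≡ 0
phrases-end {n} = phrasesFrom-done n

phrases-hop : 0 < ℓ → L y ≡ ℓ → y < n → phrases L n y ≡ suc (phrases L n (y + ℓ))
phrases-hop {L = L} {y} {n} 0<ℓ Ly y<n =
  trans (phrases-step y<n) (cong (λ x → suc (phrases L n (y + x))) (trans (cong (1 ⊔_) Ly) (m≤n⇒m⊔n≡n 0<ℓ)))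

phrases-last : n ≡ suc p → phrases L n p ≡ 1
phrases-last {n} {p} {L} refl = trans (phrases-step ≤-refl) (cong suc (phrases-end (<-jump p (L p))))

phrases-split : a ≤ n → (∀ p → p < a → L p ≡ L′ p × p + (1 ⊔ L p) ≤ a) →
                phrases L n 0 ≡ phrases L′ a 0 + phrases L n a
phrases-split {a} {n} {L} {L′} a≤n agree = go a 0 (m∸n≤m a 0) z≤n
  where
  open ≡-Reasoning
  go : ∀ k p → a ∸ p ≤ k → p ≤ a → phrases L n p ≡ phrases L′ a p + phrases L n a
  go k p _ p≤a with m≤n⇒m<n∨m≡n p≤a
  ... | inj₂ refl = cong (_+ phrases L n p) (sym (phrases-end {n = p} {L = L′} ≤-refl))
  go zero p a∸p≤0 _ | inj₁ p<a = contradiction a∸p≤0 (<⇒≱ (m<n⇒0<n∸m p<a))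
  go (suc k) p a∸p≤ _ | inj₁ p<a = begin
    phrases L n p                                        ≡⟨ phrases-step (<-≤-trans p<a a≤n) ⟩
    suc (phrases L n q)                                  ≡⟨ cong suc (go k q (∸-jump a p (L p) a∸p≤) (proj₂ (agree p p<a))) ⟩
    suc (phrases L′ a q + phrases L n a)                 ≡⟨ cong (λ x → suc (phrases L′ a (p + (1 ⊔ x)) + phrases L n a))
                                                                 (proj₁ (agree p p<a)) ⟩
    suc (phrases L′ a (p + (1 ⊔ L′ p)) + phrases L n a)  ≡⟨ cong (_+ phrases L n a) (phrases-step p<a) ⟨
    phrases L′ a p + phrases L n a                       ∎
    where q = p + (1 ⊔ L p)

-- A separator splits the factorization

module _ {c : ℕ} where

  lcp-separated : ∀ (u v X Y : List ℕ) → All (_< c) u → length v < length u →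
                  lcp (u ++ c ∷ X) (v ++ c ∷ Y) ≡ lcp (u ++ c ∷ []) (v ++ c ∷ [])
  lcp-separated (a ∷ u) [] X Y (a<c ∷ _) _ with a ≟ c
  ... | yes refl = contradiction a<c (<-irrefl refl)
  ... | no _ = refl
  lcp-separated (a ∷ u) (b ∷ v) X Y (_ ∷ u<c) (s≤s |v|<|u|) with a ≟ b
  ... | yes _ = cong suc (lcp-separated u v X Y u<c |v|<|u|)
  ... | no _ = refl

  lcp-separated-≤ : ∀ (u v X Y : List ℕ) → All (_< c) u → length v < length u →
                    lcp (u ++ c ∷ X) (v ++ c ∷ Y) ≤ length v
  lcp-separated-≤ (a ∷ u) [] X Y (a<c ∷ _) _ with a ≟ c
  ... | yes refl = contradiction a<c (<-irrefl refl)
  ... | no _ = z≤n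
  lcp-separated-≤ (a ∷ u) (b ∷ v) X Y (_ ∷ u<c) (s≤s |v|<|u|) with a ≟ b
  ... | yes _ = s≤s (lcp-separated-≤ u v X Y u<c |v|<|u|)
  ... | no _ = z≤n

  module Separated {A₀ : List ℕ} (A₀<c : All (_< c) A₀) (B : List ℕ) where

    private
      S A : List ℕ
      S = A₀ ++ c ∷ B
      A = A₀ ++ c ∷ []

      length-drop-< : j < p → p ≤ length A₀ → length (drop p A₀) < length (drop j A₀)
      length-drop-< {j} {p} j<p p≤ = subst₂ _<_ (sym (length-drop p A₀)) (sym (length-drop j A₀))
        (subst (_≤ length A₀ ∸ j) (+-∸-assoc 1 p≤) (∸-monoʳ-≤ (suc (length A₀)) j<p))

    lcp-before-separator : j < p → p ≤ length A₀ →
      lcp (drop j S) (drop p S) ≡ lcp (drop j A) (drop p A) × lcp (drop j S) (drop p S) ≤ length A₀ ∸ p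
    lcp-before-separator {j} {p} j<p p≤
      rewrite drop-++ j A₀ (c ∷ B) (≤-trans (<⇒≤ j<p) p≤) | drop-++ p A₀ (c ∷ B) p≤
            | drop-++ j A₀ (c ∷ []) (≤-trans (<⇒≤ j<p) p≤) | drop-++ p A₀ (c ∷ []) p≤ =
        lcp-separated (drop j A₀) (drop p A₀) B B (drop⁺ j A₀<c) shorter
      , subst (lcp (drop j A₀ ++ c ∷ B) (drop p A₀ ++ c ∷ B) ≤_) (length-drop p A₀)
              (lcp-separated-≤ (drop j A₀) (drop p A₀) B B (drop⁺ j A₀<c) shorter)
      where
      shorter = length-drop-< j<p p≤

    maxBelow-before-separator : ∀ (h : ℕ → ℕ → ℕ) → (∀ x j → h x j ≤ x) → p ≤ length A₀ →
      maxBelow (λ j → h (lcp (drop j S) (drop p S)) j) p ≡ maxBelow (λ j → h (lcp (drop j A) (drop p A)) j) p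
      × maxBelow (λ j → h (lcp (drop j S) (drop p S)) j) p ≤ length A₀ ∸ p
    maxBelow-before-separator {p} h h≤ p≤ =
        maxBelow-cong _ _ p (λ j j<p → cong (λ x → h x j) (proj₁ (lcp-before-separator j<p p≤)))
      , maxBelow-least _ p (λ j j<p → ≤-trans (h≤ _ j) (proj₂ (lcp-before-separator j<p p≤)))

    phrases-separated : ∀ L L′ → (∀ p → p ≤ length A₀ → L p ≡ L′ p × L p ≤ length A₀ ∸ p) →
      phrases L (length S) 0 ≡ phrases L′ (length A) 0 + phrases L (length S) (length A)
    phrases-separated L L′ agree = phrases-split A≤S within
      where
      A≤S : length A ≤ length S
      A≤S = subst₂ _≤_ (sym (length-++ A₀)) (sym (length-++ A₀)) (+-monoʳ-≤ (length A₀) (s≤s z≤n))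
      within : ∀ p → p < length A → L p ≡ L′ p × p + (1 ⊔ L p) ≤ length A
      within p p< = proj₁ (agree p p≤) , subst (p + (1 ⊔ L p) ≤_) (sym (length-∷ʳ A₀)) (begin
          p + (1 ⊔ L p)             ≤⟨ +-monoʳ-≤ p (⊔-monoʳ-≤ 1 (proj₂ (agree p p≤))) ⟩
          p + (1 ⊔ (length A₀ ∸ p)) ≤⟨ +-monoʳ-≤ p (m⊔n≤m+n 1 _) ⟩
          p + suc (length A₀ ∸ p)   ≡⟨ +-suc p _ ⟩
          suc (p + (length A₀ ∸ p)) ≡⟨ cong suc (m+[n∸m]≡n p≤) ⟩
          suc (length A₀)           ∎)
        where
        open ≤-Reasoning
        p≤ = s≤s⁻¹ (subst (p <_) (length-∷ʳ A₀) p<)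

    z-separated : z S ≡ z A + phrases (LPF S) (length S) (length A)
    z-separated = phrases-separated (LPF S) (LPF A) (λ _ → maxBelow-before-separator (λ x _ → x) (λ _ _ → ≤-refl))

    zno-separated : zno S ≡ zno A + phrases (LPnF S) (length S) (length A)
    zno-separated =
      phrases-separated (LPnF S) (LPnF A) (λ p → maxBelow-before-separator (λ x j → x ⊓ (p ∸ j)) (λ x _ → m⊓n≤m x _))

-- Exact values of LPF and LPnF

PrevFactor : List ℕ → ℕ → ℕ → Set
PrevFactor S y ℓ = LPF S y ≡ ℓ × LPnF S y ≡ ℓ

AbsentBefore : List ℕ → List ℕ → ℕ → Set
AbsentBefore W S y = ∀ j → j < y → ¬ W ⊑ drop j S

absent-∷ : ∀ a → AbsentBefore W s (suc y) → AbsentBefore (a ∷ W) s y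
absent-∷ {s = s} a absent j j<y W⊑ = absent (suc j) (s≤s j<y) (⊑-drop-∷ j s W⊑)

prevFactor-exact : ∀ S j₀ → j₀ + ℓ ≤ y → 0 < ℓ → ℓ ≤ lcp (drop j₀ S) (drop y S) →
  (∀ j → j < y → lcp (drop j S) (drop y S) ≤ ℓ) → PrevFactor S y ℓ
prevFactor-exact {ℓ} {y} S j₀ j₀+ℓ≤y 0<ℓ ℓ≤lcp lcp≤ℓ =
    ≤-antisym (maxBelow-least _ y lcp≤ℓ) (≤-trans ℓ≤lcp (≤-maxBelow _ y j₀<y))
  , ≤-antisym (maxBelow-least _ y (λ j j<y → ≤-trans (m⊓n≤m _ _) (lcp≤ℓ j j<y)))
              (≤-trans (⊓-glb ℓ≤lcp ℓ≤y∸j₀) (≤-maxBelow (λ j → lcp (drop j S) (drop y S) ⊓ (y ∸ j)) y j₀<y))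
  where
  j₀<y : j₀ < y
  j₀<y = <-≤-trans (subst (j₀ <_) (+-comm ℓ j₀) (m<n+m j₀ 0<ℓ)) j₀+ℓ≤y
  ℓ≤y∸j₀ : ℓ ≤ y ∸ j₀
  ℓ≤y∸j₀ = subst (_≤ y ∸ j₀) (m+n∸m≡n j₀ ℓ) (∸-monoˡ-≤ j₀ j₀+ℓ≤y)

copy-before : ∀ A B → Occurs W A → length A ≤ y → drop y (A ++ B) ≡ W ++ V →
  ∃ λ j₀ → j₀ + length W ≤ y × length W ≤ lcp (drop j₀ (A ++ B)) (drop y (A ++ B))
copy-before {W} {y} {V} _ B (U , V₀ , refl) A≤y drop-y = length U , U+W≤y , W≤lcp
  where
  drop-U : drop (length U) ((U ++ W ++ V₀) ++ B) ≡ W ++ V₀ ++ B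
  drop-U = trans (cong (drop (length U)) (trans (++-assoc U (W ++ V₀) B) (cong (U ++_) (++-assoc W V₀ B))))
                 (drop-length-++ U (W ++ V₀ ++ B))
  W≤lcp : length W ≤ lcp (drop (length U) ((U ++ W ++ V₀) ++ B)) (drop y ((U ++ W ++ V₀) ++ B))
  W≤lcp rewrite drop-U | drop-y = lcp-++ W (V₀ ++ B) V
  U+W≤y : length U + length W ≤ y
  U+W≤y = ≤-trans (m≤m+n _ (length V₀)) (≤-trans (≤-reflexive length-A) A≤y)
    where
    length-A : length U + length W + length V₀ ≡ length (U ++ W ++ V₀)
    length-A = trans (+-assoc (length U) _ _) (sym (trans (length-++ U) (cong (length U +_) (length-++ W))))

prevFactor-fresh : ∀ A B → Occurs W A → length A ≤ y → 0 < length W →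
  drop y (A ++ B) ≡ W ++ x ∷ V → AbsentBefore (W ++ x ∷ []) (A ++ B) y → PrevFactor (A ++ B) y (length W)
prevFactor-fresh {W} {y} {x} {V} A B W∈A A≤y 0<W drop-y fresh with copy-before A B W∈A A≤y drop-y
... | j₀ , j₀+W≤y , W≤lcp = prevFactor-exact (A ++ B) j₀ j₀+W≤y 0<W W≤lcp lcp≤W
  where
  lcp≤W : ∀ j → j < y → lcp (drop j (A ++ B)) (drop y (A ++ B)) ≤ length W
  lcp≤W j j<y with lcp (drop j (A ++ B)) (drop y (A ++ B)) ≤? length W
  ... | yes ≤W = ≤W
  ... | no ≰W = contradiction (lcp⇒⊑ (W ++ x ∷ []) V (drop j (A ++ B)) Wx≤lcp) (fresh j j<y)
    where
    Wx≤lcp : length (W ++ x ∷ []) ≤ lcp (drop j (A ++ B)) ((W ++ x ∷ []) ++ V)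
    Wx≤lcp = subst₂ (λ k s → k ≤ lcp (drop j (A ++ B)) s) (sym (length-∷ʳ W))
                    (trans drop-y (sym (++-assoc W (x ∷ []) V))) (≰⇒> ≰W)

prevFactor-suffix : ∀ A B → Occurs W A → length A ≤ y → 0 < length W →
  drop y (A ++ B) ≡ W → PrevFactor (A ++ B) y (length W)
prevFactor-suffix {W} {y} A B W∈A A≤y 0<W drop-y
  with copy-before {V = []} A B W∈A A≤y (trans drop-y (sym (++-identityʳ W)))
... | j₀ , j₀+W≤y , W≤lcp = prevFactor-exact (A ++ B) j₀ j₀+W≤y 0<W W≤lcp
      (λ j _ → subst (λ s → lcp (drop j (A ++ B)) s ≤ length W) (sym drop-y) (lcp≤length (drop j (A ++ B)) W))

Avoids : List ℕ → List ℕ → List ℕ → Set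
Avoids W [] R = ⊤
Avoids W (x ∷ X) R = ¬ W ⊑ x ∷ X ++ R × Avoids W X R

avoids-++ : ∀ X → Avoids W X (Y ++ s) → Avoids W Y s → Avoids W (X ++ Y) s
avoids-++ [] _ avY = avY
avoids-++ {W} {Y} {s} (x ∷ X) (W⋢ , avX) avY =
  W⋢ ∘ subst (W ⊑_) (cong (x ∷_) (++-assoc X Y s)) , avoids-++ X avX avY

absent⇒avoids : ∀ X → AbsentBefore W (X ++ s) (length X) → Avoids W X s
absent⇒avoids [] _ = tt
absent⇒avoids (x ∷ X) absent = absent 0 z<s , absent⇒avoids X (λ j j< → absent (suc j) (s≤s j<))

avoids⇒absent : ∀ X → Avoids W X s → AbsentBefore W (X ++ s) (length X)
avoids⇒absent (x ∷ X) (W⋢ , _) zero _ = W⋢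
avoids⇒absent (x ∷ X) (_ , avX) (suc j) (s≤s j<) = avoids⇒absent X avX j j<

avoids-separated : ∀ u → All (_< c) W → (∀ t → ¬ W ⊑ drop t u) → Avoids W X s → Avoids W (u ++ c ∷ X) s
avoids-separated [] W<c absent avX = absent 0 ∘ ⊑-before-separator [] W<c , avX
avoids-separated {c} {W} {X} {s} (x ∷ u) W<c absent avX =
    absent 0 ∘ ⊑-before-separator (x ∷ u) W<c ∘ subst (W ⊑_) (cong (x ∷_) (++-assoc u (c ∷ X) s))
  , avoids-separated u W<c (absent ∘ suc) avX

infixl 5 _‼_
_‼_ : List ℕ → ℕ → ℕ
[] ‼ _ = 0
(x ∷ _) ‼ zero = x
(_ ∷ xs) ‼ suc i = xs ‼ i

‼-++ˡ : ∀ X → i < length X → (X ++ Y) ‼ i ≡ X ‼ i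
‼-++ˡ {zero} (x ∷ X) _ = refl
‼-++ˡ {suc i} (x ∷ X) (s≤s i<) = ‼-++ˡ X i<

‼-++ʳ : ∀ X → (X ++ Y) ‼ (length X + i) ≡ Y ‼ i
‼-++ʳ [] = refl
‼-++ʳ (x ∷ X) = ‼-++ʳ X

‼-drop : ∀ t s → drop t s ‼ i ≡ s ‼ (t + i)
‼-drop zero s = refl
‼-drop (suc t) [] = refl
‼-drop (suc t) (x ∷ s) = ‼-drop t s

‼-All : ∀ {P : ℕ → Set} {X} → All P X → i < length X → P (X ‼ i)
‼-All {zero} (px ∷ _) _ = px
‼-All {suc i} (_ ∷ pX) (s≤s i<) = ‼-All pX i<

⊑-drop-‼ : ∀ t s → W ⊑ drop t s → i < length W → W ‼ i ≡ s ‼ (t + i)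
⊑-drop-‼ {W} t s (r , eq) i< = trans (sym (‼-++ˡ W i<)) (trans (cong (_‼ _) (sym eq)) (‼-drop t s))

Binary Primed : ℕ → Set
Binary x = x < 2
Primed x = 2 ≤ x × x < 4

binary-primed : Binary x → ¬ Primed x
binary-primed x<2 (2≤x , _) = <⇒≱ x<2 2≤x

binary<4 : Binary x → x < 4
binary<4 b = <-trans b (s≤s (s≤s z<s))

Pattern : ℕ → List ℕ → Set
Pattern m P = length P ≡ m × All Binary P

prime-Primed : ∀ {P} → All Binary P → All Primed (prime P)
prime-Primed [] = []
prime-Primed (b ∷ bs) = (s≤s (s≤s z≤n) , s≤s (s≤s b)) ∷ prime-Primed bs

prime-injective : ∀ {P Q} → prime P ≡ prime Q → P ≡ Q
prime-injective = map-injective (suc-injective ∘ suc-injective)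

length-prime : ∀ {m} P → Pattern m P → length (prime P) ≡ m
length-prime P (|P| , _) = trans (length-map (2 +_) P) |P|

⊑-binary-primed : ∀ t s → W ⊑ drop t s → i < length W → Binary (W ‼ i) → ¬ Primed (s ‼ (t + i))
⊑-binary-primed t s W⊑ i< b = binary-primed (subst Binary (⊑-drop-‼ t s W⊑ i<) b)

⊑-primed-binary : ∀ t s → W ⊑ drop t s → i < length W → Primed (W ‼ i) → ¬ Binary (s ‼ (t + i))
⊑-primed-binary t s W⊑ i< p b = binary-primed b (subst Primed (⊑-drop-‼ t s W⊑ i<) p)

primed-⋢-binary : ∀ {u} → i < length W → Primed (W ‼ i) → All Binary u → ¬ W ⊑ drop t u
primed-⋢-binary {t = t} i< p u-bin W⊑ = binary-primed (‼-All (⊑-All (drop⁺ t u-bin) W⊑) i<) p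

binary-pair-⋢-∷-primed : ∀ {u} → 1 < length W → Binary (W ‼ 0) → Binary (W ‼ 1) → All Primed u →
                         ¬ W ⊑ drop t (x ∷ u)
binary-pair-⋢-∷-primed {t = zero} {x = x} {u = u} 1<W _ b₁ u-pr W⊑ =
  ⊑-binary-primed 0 (x ∷ u) W⊑ 1<W b₁ (‼-All u-pr (s≤s⁻¹ (<-≤-trans 1<W (⊑-length W⊑))))
binary-pair-⋢-∷-primed {t = suc t} 1<W b₀ _ u-pr W⊑ =
  binary-primed b₀ (‼-All (⊑-All (drop⁺ t u-pr) W⊑) (<-trans z<s 1<W))

binary-⋢-primed-∷ʳ : ∀ {u} → 1 < length W → Binary (W ‼ 0) → All Primed u → ¬ W ⊑ drop t (u ++ x ∷ [])
binary-⋢-primed-∷ʳ {W} {t} {x} {u} 1<W b₀ u-pr W⊑ with t <? length u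
... | yes t<u = ⊑-binary-primed t (u ++ x ∷ []) W⊑ (<-trans z<s 1<W) b₀ (subst Primed u‼t (‼-All u-pr t<u))
  where
  u‼t : u ‼ t ≡ (u ++ x ∷ []) ‼ (t + 0)
  u‼t = trans (sym (‼-++ˡ u t<u)) (cong ((u ++ x ∷ []) ‼_) (sym (+-identityʳ t)))
... | no t≮u = <⇒≱ 1<W (begin
  length W                      ≤⟨ ⊑-length W⊑ ⟩
  length (drop t (u ++ x ∷ [])) ≡⟨ length-drop t (u ++ x ∷ []) ⟩
  length (u ++ x ∷ []) ∸ t      ≡⟨ cong (_∸ t) (length-∷ʳ u) ⟩
  suc (length u) ∸ t            ≤⟨ ∸-monoˡ-≤ t (s≤s (≮⇒≥ t≮u)) ⟩
  suc t ∸ t                     ≡⟨ m+n∸n≡m 1 t ⟩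
  1                             ∎)
  where open ≤-Reasoning

m<m+m : ∀ {m} → t < m + m → m < m + m
m<m+m {m = suc m} _ = m<m+n (suc m) z<s

module Block {m : ℕ} {Q R : List ℕ} (Q-pat : Pattern m Q) (R₀ : Binary (R ‼ 0)) where

  block : List ℕ
  block = Q ++ prime Q ++ R

  binary-zone : k < m → Binary (block ‼ k)
  binary-zone k<m = subst Binary (sym (‼-++ˡ Q k<Q)) (‼-All (proj₂ Q-pat) k<Q)
    where k<Q = subst (_ <_) (sym (proj₁ Q-pat)) k<m

  primed-zone : m ≤ k → k < m + m → Primed (block ‼ k)
  primed-zone {k} m≤k k<2m = subst Primed (sym block‼k) (‼-All (prime-Primed (proj₂ Q-pat)) r<Q′)
    where
    r = k ∸ m
    r<Q′ : r < length (prime Q)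
    r<Q′ = subst (r <_) (sym (length-prime Q Q-pat)) (+-cancelˡ-< m r m (subst (_< m + m) (sym (m+[n∸m]≡n m≤k)) k<2m))
    block‼k : block ‼ k ≡ prime Q ‼ r
    block‼k = begin
      block ‼ k              ≡⟨ cong (block ‼_) (sym (m+[n∸m]≡n m≤k)) ⟩
      block ‼ (m + r)        ≡⟨ cong (λ l → block ‼ (l + r)) (sym (proj₁ Q-pat)) ⟩
      block ‼ (length Q + r) ≡⟨ ‼-++ʳ Q ⟩
      (prime Q ++ R) ‼ r     ≡⟨ ‼-++ˡ (prime Q) r<Q′ ⟩
      prime Q ‼ r            ∎
      where open ≡-Reasoning

  binary-after : Binary (block ‼ (m + m))
  binary-after = subst Binary (sym block‼2m) R₀
    where
    block‼2m : block ‼ (m + m) ≡ R ‼ 0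
    block‼2m = begin
      block ‼ (m + m)                         ≡⟨ cong (λ l → block ‼ (l + m)) (sym (proj₁ Q-pat)) ⟩
      block ‼ (length Q + m)                  ≡⟨ ‼-++ʳ Q ⟩
      (prime Q ++ R) ‼ m                      ≡⟨ cong ((prime Q ++ R) ‼_)
                                                      (sym (trans (+-identityʳ _) (length-prime Q Q-pat))) ⟩
      (prime Q ++ R) ‼ (length (prime Q) + 0) ≡⟨ ‼-++ʳ (prime Q) ⟩
      R ‼ 0                                   ∎
      where open ≡-Reasoning

  binary-run-⋢ : (∀ i → i < k → Binary (W ‼ i)) → k ≤ length W → m ∸ t < k → t < m + m → ¬ W ⊑ drop t block
  binary-run-⋢ {k} {W} {t} run k≤W m∸t<k t<2m W⊑ =
    ⊑-binary-primed t block W⊑ (<-≤-trans m∸t<k k≤W) (run (m ∸ t) m∸t<k) (primed-zone (m≤n+m∸n m t) t+m∸t<2m)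
    where
    t+m∸t<2m : t + (m ∸ t) < m + m
    t+m∸t<2m with t ≤? m
    ... | yes t≤m = subst (_< m + m) (sym (m+[n∸m]≡n t≤m)) (m<m+m t<2m)
    ... | no t≰m = subst (_< m + m) (sym (trans (cong (t +_) (m≤n⇒m∸n≡0 (<⇒≤ (≰⇒> t≰m)))) (+-identityʳ t))) t<2m

∸-suc-< : 0 < a → a ∸ suc k < a
∸-suc-< {suc a} {k} _ = s≤s (m∸n≤m a k)

length-tailD : ∀ {P : List ℕ} → length P ≡ suc n → length (tailD P) ≡ n
length-tailD {P = _ ∷ _} = suc-injective

length-initD : ∀ {P : List ℕ} → length P ≡ suc n → length (initD P) ≡ n
length-initD {P = a ∷ P} = trans (length-initD-∷ a P) ∘ suc-injective
  where
  length-initD-∷ : ∀ a P → length (initD (a ∷ P)) ≡ length P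
  length-initD-∷ a [] = refl
  length-initD-∷ a (b ∷ P) = cong suc (length-initD-∷ b P)

initD-++-lastD : ∀ a P (X : List ℕ) → initD (a ∷ P) ++ lastD (a ∷ P) ∷ X ≡ a ∷ P ++ X
initD-++-lastD a [] X = refl
initD-++-lastD a (b ∷ P) X = cong (a ∷_) (initD-++-lastD b P X)

tailD-All : ∀ {P : ℕ → Set} {X} → All P X → All P (tailD X)
tailD-All [] = []
tailD-All (_ ∷ px) = px

initD-All : ∀ {P : ℕ → Set} {X} → All P X → All P (initD X)
initD-All [] = []
initD-All (_ ∷ []) = []
initD-All (px ∷ pxs@(_ ∷ _)) = px ∷ initD-All pxs

lastD-binary : ∀ {P : List ℕ} → All Binary P → Binary (lastD P)
lastD-binary [] = z<s
lastD-binary (b ∷ []) = b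
lastD-binary (_ ∷ bs@(_ ∷ _)) = lastD-binary bs

distinct-before : ∀ {P : List ℕ} pre {rest} → Unique (pre ++ P ∷ rest) → All (_≢ P) pre
distinct-before [] _ = []
distinct-before (Q ∷ pre) (Q≢ ∷ u) = All.head (++⁻ʳ pre Q≢) ∷ distinct-before pre u

-- The reduction

module Reduction (T : List ℕ) (n : ℕ) (1<n : 1 < n) (D : List (List ℕ))
                 (T-bin : All Binary T) (D-pat : All (Pattern (suc n)) D) (D-unique : Unique D) where

  m : ℕ
  m = suc n

  1<m : 1 < m
  1<m = s≤s (<⇒≤ 1<n)

  A S : List ℕ
  A = S1 T ++ S2 D
  S = A ++ S3 D

  -- The block of the pattern that follows pre in D starts at position y₀ pre of S.
  y₀ : List (List ℕ) → ℕ
  y₀ pre = length (S3body pre) + length A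

  length-block : ∀ {Q} → Pattern m Q → length (Q ++ prime Q) ≡ m + m
  length-block {Q} Q-pat = trans (length-++ Q) (cong₂ _+_ (proj₁ Q-pat) (length-prime Q Q-pat))

  pattern-head : ∀ {P X} → Pattern m P → Binary ((P ++ X) ‼ 0)
  pattern-head {_ ∷ _} (_ , b ∷ _) = b

  S3body-binary : ∀ {E R} → All (Pattern m) E → Binary (R ‼ 0) → Binary ((S3body E ++ R) ‼ 0)
  S3body-binary [] R₀ = R₀
  S3body-binary {(_ ∷ _) ∷ E} ((_ , b ∷ _) ∷ _) _ = b

  nextFirst-binary : ∀ {rest} → All (Pattern m) rest → Binary (nextFirst rest)
  nextFirst-binary [] = z<s
  nextFirst-binary {(_ ∷ _) ∷ _} ((_ , b ∷ _) ∷ _) = b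

  S3-head : ∀ {rest} → All (Pattern m) rest → ∃ λ V → S3 rest ≡ nextFirst rest ∷ V
  S3-head [] = [] , refl
  S3-head {(_ ∷ _) ∷ _} _ = _ , refl

  S3-cases : ∀ {rest} → All (Pattern m) rest →
    (S3 rest ≡ nextFirst rest ∷ []) ⊎ (∃ λ b → ∃ λ V → Binary b × S3 rest ≡ nextFirst rest ∷ b ∷ V)
  S3-cases [] = inj₁ refl
  S3-cases {(_ ∷ []) ∷ _} ((|Q| , _) ∷ _) = contradiction (suc-injective |Q|) (<⇒≢ (<-trans z<s 1<n))
  S3-cases {(_ ∷ b ∷ _) ∷ _} ((_ , _ ∷ b-bin ∷ _) ∷ _) = inj₂ (b , _ , b-bin , refl)

  record Split (pre : List (List ℕ)) (P : List ℕ) (rest : List (List ℕ)) : Set where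
    field
      D≡ : D ≡ pre ++ P ∷ rest
      pre-pat : All (Pattern m) pre
      P-pat : Pattern m P
      rest-pat : All (Pattern m) rest
      pre-≢ : All (_≢ P) pre

  split : ∀ pre {P rest} → D ≡ pre ++ P ∷ rest → Split pre P rest
  split pre {P} {rest} D≡ = record
    { D≡ = D≡
    ; pre-pat = ++⁻ˡ pre pats
    ; P-pat = All.head (++⁻ʳ pre pats)
    ; rest-pat = All.tail (++⁻ʳ pre pats)
    ; pre-≢ = distinct-before pre (subst Unique D≡ D-unique)
    }
    where
    pats : All (Pattern m) (pre ++ P ∷ rest)
    pats = subst (All (Pattern m)) D≡ D-pat

  no-empty-pattern : ∀ {pre rest} → ¬ Split pre [] rest
  no-empty-pattern sp with Split.P-pat sp
  ... | () , _

  S3body-++ : ∀ E F → S3body (E ++ F) ≡ S3body E ++ S3body F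
  S3body-++ [] F = refl
  S3body-++ (Q ∷ E) F = trans (cong (λ Z → Q ++ prime Q ++ Z) (S3body-++ E F))
    (sym (trans (++-assoc Q _ _) (cong (Q ++_) (++-assoc (prime Q) _ _))))

  S3-∷ : ∀ P rest → S3 (P ∷ rest) ≡ P ++ prime P ++ S3 rest
  S3-∷ P rest = trans (++-assoc P _ _) (cong (P ++_) (++-assoc (prime P) _ _))

  S-split : ∀ pre rest → D ≡ pre ++ rest → S ≡ (A ++ S3body pre) ++ S3 rest
  S-split pre rest D≡ = begin
    A ++ S3body D ++ 0 ∷ []                     ≡⟨ cong (λ E → A ++ S3body E ++ 0 ∷ []) D≡ ⟩
    A ++ S3body (pre ++ rest) ++ 0 ∷ []         ≡⟨ cong (λ Z → A ++ Z ++ 0 ∷ []) (S3body-++ pre rest) ⟩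
    A ++ (S3body pre ++ S3body rest) ++ 0 ∷ []  ≡⟨ cong (A ++_) (++-assoc (S3body pre) _ _) ⟩
    A ++ S3body pre ++ S3 rest                  ≡⟨ ++-assoc A _ _ ⟨
    (A ++ S3body pre) ++ S3 rest                ∎
    where open ≡-Reasoning

  S-at : ∀ {pre P rest} → Split pre P rest → ∀ u {R} → u ++ R ≡ P ++ prime P ++ S3 rest →
         S ≡ ((A ++ S3body pre) ++ u) ++ R
  S-at {pre} {P} {rest} sp u {R} u++R≡ = begin
    S                                  ≡⟨ S-split pre (P ∷ rest) (Split.D≡ sp) ⟩
    (A ++ S3body pre) ++ S3 (P ∷ rest) ≡⟨ cong ((A ++ S3body pre) ++_) (trans (S3-∷ P rest) (sym u++R≡)) ⟩
    (A ++ S3body pre) ++ u ++ R        ≡⟨ ++-assoc _ u R ⟨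
    ((A ++ S3body pre) ++ u) ++ R      ∎
    where open ≡-Reasoning

  length-A-pre-u : ∀ pre u → length ((A ++ S3body pre) ++ u) ≡ length u + y₀ pre
  length-A-pre-u pre u = begin
    length ((A ++ S3body pre) ++ u)              ≡⟨ length-++ (A ++ S3body pre) ⟩
    length (A ++ S3body pre) + length u          ≡⟨ cong (_+ length u) (length-++ A) ⟩
    length A + length (S3body pre) + length u    ≡⟨ reorder (length A) _ _ ⟩
    length u + (length (S3body pre) + length A)  ∎
    where
    open ≡-Reasoning
    reorder : ∀ a b c → a + b + c ≡ c + (b + a)
    reorder = solve-∀

  drop-S : ∀ {pre P rest} → Split pre P rest → ∀ u {R} → u ++ R ≡ P ++ prime P ++ S3 rest →
           drop (length u + y₀ pre) S ≡ R
  drop-S {pre} sp u {R} u++R≡ =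
    trans (cong₂ drop (sym (length-A-pre-u pre u)) (S-at sp u u++R≡)) (drop-length-++ ((A ++ S3body pre) ++ u) R)

  length-S : ∀ pre rest → D ≡ pre ++ rest → length S ≡ length (S3 rest) + y₀ pre
  length-S pre rest D≡ = trans (cong length (S-split pre rest D≡)) (length-A-pre-u pre (S3 rest))

  y₀-snoc : ∀ pre {P} → Pattern m P → y₀ (pre ++ P ∷ []) ≡ m + m + y₀ pre
  y₀-snoc pre {P} P-pat = begin
    length (S3body (pre ++ P ∷ [])) + length A                   ≡⟨ cong (λ Z → length Z + length A) (S3body-++ pre (P ∷ [])) ⟩
    length (S3body pre ++ P ++ prime P ++ []) + length A         ≡⟨ cong (_+ length A) (length-++ (S3body pre)) ⟩
    length (S3body pre) + length (P ++ prime P ++ []) + length A ≡⟨ cong (λ k → length (S3body pre) + k + length A) |block| ⟩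
    length (S3body pre) + (m + m) + length A                     ≡⟨ reorder (length (S3body pre)) (m + m) (length A) ⟩
    m + m + y₀ pre                                               ∎
    where
    open ≡-Reasoning
    |block| : length (P ++ prime P ++ []) ≡ m + m
    |block| = trans (cong length (sym (++-assoc P (prime P) [])))
                    (trans (cong length (++-identityʳ (P ++ prime P))) (length-block P-pat))
    reorder : ∀ a b c → a + b + c ≡ b + (a + c)
    reorder = solve-∀

  within-block : ∀ {pre P rest} → Split pre P rest → k ≤ m + m → k + y₀ pre < length S
  within-block {k} {pre} {P} {rest} sp k≤2m = subst (k + y₀ pre <_) (sym (length-S pre (P ∷ rest) (Split.D≡ sp)))
    (+-monoˡ-< (y₀ pre) (≤-<-trans k≤2m (subst (m + m <_) (sym |S3|) (+-monoʳ-< m (m<m+n m z<s)))))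
    where
    |S3| : length (S3 (P ∷ rest)) ≡ m + (m + suc (length (S3body rest)))
    |S3| = begin
      length (S3 (P ∷ rest))                           ≡⟨ cong length (S3-∷ P rest) ⟩
      length (P ++ prime P ++ S3 rest)                 ≡⟨ length-++ P ⟩
      length P + length (prime P ++ S3 rest)           ≡⟨ cong (length P +_) (length-++ (prime P)) ⟩
      length P + (length (prime P) + length (S3 rest)) ≡⟨ cong₂ (λ a b → a + (b + length (S3 rest)))
                                                                (proj₁ (Split.P-pat sp)) (length-prime P (Split.P-pat sp)) ⟩
      m + (m + length (S3 rest))                       ≡⟨ cong (λ k → m + (m + k)) (length-∷ʳ (S3body rest)) ⟩
      m + (m + suc (length (S3body rest)))             ∎
      where open ≡-Reasoning

  occurs-S2body-++ : ∀ {X} pre {E} → Occurs X (S2body E) → Occurs X (S2body (pre ++ E))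
  occurs-S2body-++ [] X∈E = X∈E
  occurs-S2body-++ (Q ∷ pre) {E} X∈E =
    occurs-++ʳ (tailD Q) (occurs-++ʳ (4 ∷ initD Q) (occurs-++ʳ (4 ∷ lastD Q ∷ prime Q) (occurs-++ʳ (4 ∷ prime Q)
      (occurs-++ʳ (nextFirst (pre ++ E) ∷ 4 ∷ []) (occurs-S2body-++ pre X∈E)))))

  occurs-A : ∀ {X pre P rest} → Split pre P rest → Occurs X (S2body (P ∷ rest)) → Occurs X A
  occurs-A {pre = pre} sp X∈ =
    occurs-++ʳ (T ++ 5 ∷ []) (occurs-++ˡ (subst (λ E → Occurs _ (S2body E)) (sym (Split.D≡ sp)) (occurs-S2body-++ pre X∈)))

  -- Within the first 2m positions of any S3-block, a window of P can only sit at offset off of P's own block.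
  -- The shape excludes it from every piece of S2 between two separators.
  record Window (P : List ℕ) (off : ℕ) (W : List ℕ) : Set where
    field
      small : All (_< 4) W
      shape : (m ≤ length W × Binary (W ‼ 0) × Binary (W ‼ 1)) ⊎ (2 + m ≤ length W)
      absent-T : ∀ t → ¬ W ⊑ drop t T
      off<2m : off < m + m
      only-at-off : ∀ {Q R} → Pattern m Q → Binary (R ‼ 0) → ∀ t → t < m + m →
                    W ⊑ drop t (Q ++ prime Q ++ R) → t ≡ off × Q ≡ P

  module _ {P off W} (w : Window P off W) where
    open Window w

    private
      m≤W : m ≤ length W
      m≤W with shape
      ... | inj₁ (m≤W , _) = m≤W
      ... | inj₂ 2+m≤W = ≤-trans (≤-trans (n≤1+n m) (n≤1+n (suc m))) 2+m≤W

      W< : 4 ≤ a → All (_< a) W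
      W< 4≤a = All.map (λ w<4 → <-≤-trans w<4 4≤a) small

      too-short : ∀ u → length u < length W → ∀ t → ¬ W ⊑ drop t u
      too-short u u<W t W⊑ = <⇒≱ u<W (⊑-drop-length t u W⊑)

      avoids-S2block : ∀ {Q X Y} → Pattern m Q → ∀ x → Avoids W X Y →
        Avoids W (tailD Q ++ 4 ∷ initD Q ++ 4 ∷ lastD Q ∷ prime Q ++ 4 ∷ prime Q ++ x ∷ 4 ∷ X) Y
      avoids-S2block {Q} {X} {Y} Q-pat@(|Q| , Q-bin) x avX =
          avoids-separated (tailD Q) (W< ≤-refl) (too-short (tailD Q) (subst (_< length W) (sym |tailD|) m≤W))
        ( avoids-separated (initD Q) (W< ≤-refl) (too-short (initD Q) (subst (_< length W) (sym |initD|) m≤W))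
        ( avoids-separated (lastD Q ∷ prime Q) (W< ≤-refl) last-prime
        ( subst (λ Z → Avoids W Z Y) (++-assoc (prime Q) (x ∷ []) (4 ∷ X))
            (avoids-separated (prime Q ++ x ∷ []) (W< ≤-refl) prime-x avX))))
        where
        |tailD| = length-tailD {P = Q} |Q|
        |initD| = length-initD {P = Q} |Q|
        |prime-Q| = length-prime Q Q-pat
        last-prime : ∀ t → ¬ W ⊑ drop t (lastD Q ∷ prime Q)
        last-prime with shape
        ... | inj₁ (_ , b₀ , b₁) = λ t → binary-pair-⋢-∷-primed {t = t} (<-≤-trans 1<m m≤W) b₀ b₁ (prime-Primed Q-bin)
        ... | inj₂ 2+m≤W = too-short (lastD Q ∷ prime Q) (subst (_< length W) (cong suc (sym |prime-Q|)) 2+m≤W)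
        prime-x : ∀ t → ¬ W ⊑ drop t (prime Q ++ x ∷ [])
        prime-x with shape
        ... | inj₁ (_ , b₀ , _) = λ t → binary-⋢-primed-∷ʳ {t = t} (<-≤-trans 1<m m≤W) b₀ (prime-Primed Q-bin)
        ... | inj₂ 2+m≤W =
          too-short (prime Q ++ x ∷ []) (subst (_< length W) (sym (trans (length-∷ʳ (prime Q)) (cong suc |prime-Q|))) 2+m≤W)

    avoids-S2body : ∀ {E Y} → All (Pattern m) E → Avoids W (S2body E) Y
    avoids-S2body [] = tt
    avoids-S2body {Q ∷ E} (Q-pat ∷ E-pat) = avoids-S2block Q-pat (nextFirst E) (avoids-S2body E-pat)

    avoids-A : ∀ {Y} → Avoids W A Y
    avoids-A = avoids-++ (T ++ 5 ∷ [])
      (avoids-separated T (W< (m≤n+m 4 1)) absent-T tt)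
      (avoids-++ (S2body D) (avoids-S2body D-pat) (avoids-separated [] (W< (m≤n+m 4 2)) (too-short [] (<-≤-trans z<s m≤W)) tt))

    avoids-S3body : ∀ {E R} → All (Pattern m) E → All (_≢ P) E → Binary (R ‼ 0) → Avoids W (S3body E) R
    avoids-S3body [] [] _ = tt
    avoids-S3body {Q ∷ E} {R} (Q-pat ∷ E-pat) (Q≢P ∷ E≢P) R₀ =
      subst (λ Z → Avoids W Z R) (++-assoc Q (prime Q) (S3body E))
        (avoids-++ (Q ++ prime Q) (absent⇒avoids (Q ++ prime Q) not-here) (avoids-S3body E-pat E≢P R₀))
      where
      not-here : AbsentBefore W ((Q ++ prime Q) ++ S3body E ++ R) (length (Q ++ prime Q))
      not-here t t<2m W⊑ = Q≢P (proj₂ (only-at-off Q-pat (S3body-binary E-pat R₀) t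
        (subst (t <_) (length-block Q-pat) t<2m) (subst (λ Z → W ⊑ drop t Z) (++-assoc Q (prime Q) _) W⊑)))

    avoids-current : ∀ {u R R′} → Pattern m P → Binary (R ‼ 0) → u ++ R′ ≡ P ++ prime P ++ R → length u ≤ off →
                     Avoids W u R′
    avoids-current {u} P-pat R₀ u++R′≡ u≤off = absent⇒avoids u λ t t<u W⊑ →
      <-irrefl (proj₁ (only-at-off P-pat R₀ t (<-≤-trans t<u (≤-trans u≤off (<⇒≤ off<2m)))
                                   (subst (λ Z → W ⊑ drop t Z) u++R′≡ W⊑)))
               (<-≤-trans t<u u≤off)

    window-absent : ∀ {pre rest} → Split pre P rest → ∀ u {R} → u ++ R ≡ P ++ prime P ++ S3 rest → length u ≤ off →
                    AbsentBefore W S (length u + y₀ pre)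
    window-absent {pre} {rest} sp u {R} u++R≡ u≤off =
      subst₂ (AbsentBefore W) (sym (S-at sp u u++R≡)) (length-A-pre-u pre u) (avoids⇒absent ((A ++ S3body pre) ++ u) avoids)
      where
      open Split sp
      avoids : Avoids W ((A ++ S3body pre) ++ u) R
      avoids = avoids-++ (A ++ S3body pre)
        (avoids-++ A avoids-A (avoids-S3body pre-pat pre-≢ (subst (λ Z → Binary (Z ‼ 0)) (sym u++R≡) (pattern-head P-pat))))
        (avoids-current P-pat (S3body-binary rest-pat z<s) u++R≡ u≤off)

  drop-n-++ : ∀ {Q Y} → Pattern m Q → drop n (Q ++ Y) ≡ lastD Q ∷ Y
  drop-n-++ {q ∷ qs} {Y} (|Q| , _) =
    trans (cong₂ drop (sym (length-initD {P = q ∷ qs} |Q|)) (sym (initD-++-lastD q qs Y))) (drop-length-++ (initD (q ∷ qs)) _)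

  drop-m-++ : ∀ {Q Y} → Pattern m Q → drop m (Q ++ Y) ≡ Y
  drop-m-++ {Q} {Y} (|Q| , _) = trans (cong (λ k → drop k (Q ++ Y)) (sym |Q|)) (drop-length-++ Q Y)

  window-pattern : ∀ {P} → Pattern m P → ¬ Occurs P T → Window P 0 P
  window-pattern {P} (|P| , P-bin) P∉T = record
    { small = All.map binary<4 P-bin
    ; shape = inj₁ (m≤P , ‼-All P-bin (<-≤-trans z<s m≤P) , ‼-All P-bin (<-≤-trans 1<m m≤P))
    ; absent-T = λ t → P∉T ∘ ⊑-drop⇒occurs t T
    ; off<2m = z<s
    ; only-at-off = only-at-0
    }
    where
    m≤P = ≤-reflexive (sym |P|)
    only-at-0 : ∀ {Q R} → Pattern m Q → Binary (R ‼ 0) → ∀ t → t < m + m → P ⊑ drop t (Q ++ prime Q ++ R) →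
                t ≡ 0 × Q ≡ P
    only-at-0 {Q} (|Q| , _) _ zero _ P⊑ = refl , sym (⊑-++⇒≡ P Q P⊑ (trans |P| (sym |Q|)))
    only-at-0 Q-pat R₀ (suc t) t<2m P⊑ = contradiction P⊑
      (Block.binary-run-⋢ Q-pat R₀ (λ i i<m → ‼-All P-bin (<-≤-trans i<m m≤P)) m≤P (∸-suc-< {k = t} z<s) t<2m)

  window-shifted : ∀ {p ps} → Pattern m (p ∷ ps) → Window (p ∷ ps) 1 (ps ++ 2 + p ∷ [])
  window-shifted {p} {ps} (|P| , p-bin ∷ ps-bin) = record
    { small = ++⁺ (All.map binary<4 ps-bin) (s≤s (s≤s p-bin) ∷ [])
    ; shape = inj₁ (m≤U , U-binary (<-trans z<s 1<n) , U-binary 1<n)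
    ; absent-T = λ t → primed-⋢-binary {t = t} n<U U-primed T-bin
    ; off<2m = <-≤-trans 1<m (m≤m+n m m)
    ; only-at-off = only-at-1
    }
    where
    U = ps ++ 2 + p ∷ []
    |ps| : length ps ≡ n
    |ps| = suc-injective |P|
    m≤U : m ≤ length U
    m≤U = ≤-reflexive (sym (trans (length-∷ʳ ps) (cong suc |ps|)))
    n<U = <-≤-trans (n<1+n n) m≤U
    U-binary : i < n → Binary (U ‼ i)
    U-binary i<n = subst Binary (sym (‼-++ˡ ps i<ps)) (‼-All ps-bin i<ps)
      where i<ps = subst (_ <_) (sym |ps|) i<n
    U-primed : Primed (U ‼ n)
    U-primed = subst Primed (sym (trans (cong (U ‼_) (sym (trans (+-identityʳ _) |ps|))) (‼-++ʳ ps)))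
                     (s≤s (s≤s z≤n) , s≤s (s≤s p-bin))
    only-at-1 : ∀ {Q R} → Pattern m Q → Binary (R ‼ 0) → ∀ t → t < m + m → U ⊑ drop t (Q ++ prime Q ++ R) →
                t ≡ 1 × Q ≡ p ∷ ps
    only-at-1 {Q} Q-pat R₀ zero _ U⊑ =
      contradiction (Block.binary-zone Q-pat R₀ (n<1+n n)) (⊑-primed-binary 0 (Q ++ _) U⊑ n<U U-primed)
    only-at-1 {q ∷ qs} (|Q| , _) _ (suc zero) _ U⊑ with ++-⊑-++ ps qs U⊑ (trans |ps| (sym (suc-injective |Q|)))
    ... | refl , (r , eq) = refl , cong (_∷ ps) (suc-injective (suc-injective (∷-injectiveˡ eq)))
    only-at-1 Q-pat R₀ (suc (suc t)) t<2m U⊑ =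
      contradiction U⊑ (Block.binary-run-⋢ Q-pat R₀ (λ _ → U-binary) (<⇒≤ n<U) (∸-suc-< (<-trans z<s 1<n)) t<2m)

  window-last : ∀ {P x} → Pattern m P → Binary x → Window P n (lastD P ∷ prime P ++ x ∷ [])
  window-last {P} {x} P-pat@(_ , P-bin) x-bin = record
    { small = binary<4 (lastD-binary P-bin) ∷ ++⁺ (All.map proj₂ (prime-Primed P-bin)) (binary<4 x-bin ∷ [])
    ; shape = inj₂ (≤-reflexive (sym |U|))
    ; absent-T = λ t → primed-⋢-binary {t = t} 1<U U-primed T-bin
    ; off<2m = <-≤-trans (n<1+n n) (m≤m+n m m)
    ; only-at-off = only-at-n
    }
    where
    U = lastD P ∷ prime P ++ x ∷ []
    |prime-P| = length-prime P P-pat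
    |U| : length U ≡ 2 + m
    |U| = cong suc (trans (length-∷ʳ (prime P)) (cong suc |prime-P|))
    1<U : 1 < length U
    1<U = subst (1 <_) (sym |U|) (s≤s z<s)
    U-primed : Primed (U ‼ 1)
    U-primed = subst Primed (sym (‼-++ˡ (prime P) 0<prime-P)) (‼-All (prime-Primed P-bin) 0<prime-P)
      where 0<prime-P = subst (0 <_) (sym |prime-P|) z<s
    only-at-n : ∀ {Q R} → Pattern m Q → Binary (R ‼ 0) → ∀ t → t < m + m → U ⊑ drop t (Q ++ prime Q ++ R) →
                t ≡ n × Q ≡ P
    only-at-n {Q} {R} Q-pat R₀ t t<2m U⊑ with <-cmp t n
    ... | tri< t<n _ _ = contradiction (Block.binary-zone Q-pat R₀ (subst (_< m) (+-comm 1 t) (s≤s t<n)))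
                                       (⊑-primed-binary t (Q ++ _) U⊑ 1<U U-primed)
    ... | tri≈ _ refl _ with subst (U ⊑_) (drop-n-++ Q-pat) U⊑
    ...   | r , eq = refl , sym (prime-injective (⊑-++⇒≡ (prime P) (prime Q) prime-P⊑
                                                           (trans |prime-P| (sym (length-prime Q Q-pat)))))
      where
      prime-P⊑ : prime P ⊑ prime Q ++ R
      prime-P⊑ = x ∷ r , trans (∷-injectiveʳ eq) (++-assoc (prime P) (x ∷ []) r)
    only-at-n Q-pat R₀ t t<2m U⊑ | tri> _ _ n<t =
      contradiction U⊑ (Block.binary-run-⋢ Q-pat R₀ (λ { zero _ → lastD-binary P-bin ; (suc _) (s≤s ()) }) (<⇒≤ 1<U)
                                          (subst (_< 1) (sym (m≤n⇒m∸n≡0 n<t)) z<s) t<2m)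

  window-next : ∀ {P a b} → Pattern m P → Binary a → Binary b → Window P m (prime P ++ a ∷ b ∷ [])
  window-next {P} {a} {b} P-pat@(_ , P-bin) a-bin b-bin = record
    { small = ++⁺ (All.map proj₂ (prime-Primed P-bin)) (binary<4 a-bin ∷ binary<4 b-bin ∷ [])
    ; shape = inj₂ (≤-reflexive (sym |U|))
    ; absent-T = λ t → primed-⋢-binary {t = t} (<-≤-trans z<s m≤U) (U-primed z<s) T-bin
    ; off<2m = m<m+n m z<s
    ; only-at-off = only-at-m
    }
    where
    U = prime P ++ a ∷ b ∷ []
    |prime-P| = length-prime P P-pat
    |U| : length U ≡ 2 + m
    |U| = trans (length-++ (prime P)) (trans (cong (_+ 2) |prime-P|) (+-comm m 2))
    m≤U : m ≤ length U
    m≤U = subst (m ≤_) (sym |U|) (m≤n+m m 2)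
    U-primed : i < m → Primed (U ‼ i)
    U-primed i<m = subst Primed (sym (‼-++ˡ (prime P) i<prime-P)) (‼-All (prime-Primed P-bin) i<prime-P)
      where i<prime-P = subst (_ <_) (sym |prime-P|) i<m
    only-at-m : ∀ {Q R} → Pattern m Q → Binary (R ‼ 0) → ∀ t → t < m + m → U ⊑ drop t (Q ++ prime Q ++ R) →
                t ≡ m × Q ≡ P
    only-at-m {Q} {R} Q-pat R₀ t t<2m U⊑ with <-cmp t m
    ... | tri< t<m _ _ = contradiction (Block.binary-zone Q-pat R₀ (subst (_< m) (sym (+-identityʳ t)) t<m))
                                       (⊑-primed-binary t (Q ++ _) U⊑ (<-≤-trans z<s m≤U) (U-primed z<s))
    ... | tri≈ _ refl _ =
      refl , sym (prime-injective (⊑-++⇒≡ (prime P) (prime Q) prime-P⊑ (trans |prime-P| (sym (length-prime Q Q-pat)))))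
      where
      prime-P⊑ : prime P ⊑ prime Q ++ R
      prime-P⊑ with subst (U ⊑_) (drop-m-++ Q-pat) U⊑
      ... | r , eq = a ∷ b ∷ r , trans eq (++-assoc (prime P) _ r)
    ... | tri> _ _ m<t = contradiction (subst Binary (cong ((Q ++ prime Q ++ R) ‼_) (sym t+r≡2m)) (Block.binary-after Q-pat R₀))
                                       (⊑-primed-binary t (Q ++ _) U⊑ (<-≤-trans r<m m≤U) (U-primed r<m))
      where
      r = m + m ∸ t
      t+r≡2m : t + r ≡ m + m
      t+r≡2m = m+[n∸m]≡n (<⇒≤ t<2m)
      r<m : r < m
      r<m = subst (r <_) (m+n∸m≡n m m) (∸-monoʳ-< m<t (<⇒≤ t<2m))

  module AtBlock {pre p ps rest} (sp : Split pre (p ∷ ps) rest) where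
    open Split sp

    private
      P = p ∷ ps
      nf = nextFirst rest
      |ps| : length ps ≡ n
      |ps| = suc-injective (proj₁ P-pat)
      |initD| : length (initD P) ≡ n
      |initD| = length-initD {P = P} (proj₁ P-pat)
      A≤ : ∀ k → length A ≤ k + y₀ pre
      A≤ k = ≤-trans (m≤n+m (length A) (length (S3body pre))) (m≤n+m _ k)
      shifted-absent : AbsentBefore (ps ++ 2 + p ∷ []) S (suc (y₀ pre))
      shifted-absent = window-absent (window-shifted P-pat) sp (p ∷ []) refl ≤-refl

    prevFactor-shifted : PrevFactor S (suc (y₀ pre)) n
    prevFactor-shifted = subst (PrevFactor S (suc (y₀ pre))) |ps|
      (prevFactor-fresh A (S3 D) (occurs-A sp ([] , _ , refl)) (A≤ 1) (subst (0 <_) (sym |ps|) (<-trans z<s 1<n))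
        (drop-S sp (p ∷ []) refl) shifted-absent)

    prevFactor-occurs : Occurs P T → PrevFactor S (y₀ pre) m
    prevFactor-occurs P∈T = subst (PrevFactor S (y₀ pre)) (proj₁ P-pat)
      (prevFactor-fresh A (S3 D) (occurs-++ˡ (occurs-++ˡ P∈T)) (A≤ 0) z<s (drop-S sp [] refl) (absent-∷ p shifted-absent))

    prevFactor-absent : ¬ Occurs P T → PrevFactor S (y₀ pre) n
    prevFactor-absent P∉T = subst (PrevFactor S (y₀ pre)) |initD|
      (prevFactor-fresh A (S3 D) (occurs-A sp (occurs-++ʳ (tailD P) (occurs-++ʳ (4 ∷ []) ([] , _ , refl)))) (A≤ 0)
        (subst (0 <_) (sym |initD|) (<-trans z<s 1<n)) (drop-S sp [] (initD-++-lastD p ps _))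
        (subst (λ W → AbsentBefore W S (y₀ pre)) (sym (trans (initD-++-lastD p ps []) (cong (p ∷_) (++-identityʳ ps))))
          (window-absent (window-pattern P-pat P∉T) sp [] refl z≤n)))

    prevFactor-last : PrevFactor S (n + y₀ pre) (suc m)
    prevFactor-last with S3-head rest-pat
    ... | V , S3≡ = subst₂ (PrevFactor S) (cong (_+ y₀ pre) |initD|) (cong suc (length-prime P P-pat))
      (prevFactor-fresh A (S3 D) (occurs-A sp last-prime∈) (A≤ (length (initD P))) z<s drop≡
        (window-absent (window-last P-pat (nextFirst-binary rest-pat)) sp (initD P) (initD-++-lastD p ps _) (≤-reflexive |initD|)))
      where
      last-prime∈ : Occurs (lastD P ∷ prime P) (S2body (P ∷ rest))
      last-prime∈ = occurs-++ʳ (tailD P) (occurs-++ʳ (4 ∷ initD P) (occurs-++ʳ (4 ∷ []) ([] , _ , refl)))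
      drop≡ : drop (length (initD P) + y₀ pre) S ≡ (lastD P ∷ prime P) ++ nf ∷ V
      drop≡ = trans (drop-S sp (initD P) (initD-++-lastD p ps _)) (cong (λ Z → lastD P ∷ prime P ++ Z) S3≡)

    prevFactor-next : PrevFactor S (m + y₀ pre) (suc m)
    prevFactor-next = subst₂ (PrevFactor S) (cong (_+ y₀ pre) (proj₁ P-pat)) |phrase| (by-cases (S3-cases rest-pat))
      where
      phrase = prime P ++ nf ∷ []
      |phrase| : length phrase ≡ suc m
      |phrase| = trans (length-∷ʳ (prime P)) (cong suc (length-prime P P-pat))
      0<phrase : 0 < length phrase
      0<phrase = subst (0 <_) (sym |phrase|) z<s
      phrase∈A : Occurs phrase A
      phrase∈A = occurs-A sp (occurs-++ʳ (tailD P) (occurs-++ʳ (4 ∷ initD P) (occurs-++ʳ (4 ∷ lastD P ∷ prime P)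
                   (occurs-++ʳ (4 ∷ []) ([] , 4 ∷ S2body rest , sym (++-assoc (prime P) (nf ∷ []) _))))))
      drop≡ : drop (length P + y₀ pre) S ≡ prime P ++ S3 rest
      drop≡ = drop-S sp P refl
      by-cases : (S3 rest ≡ nf ∷ []) ⊎ (∃ λ b → ∃ λ V → Binary b × S3 rest ≡ nf ∷ b ∷ V) →
                 PrevFactor S (length P + y₀ pre) (length phrase)
      by-cases (inj₁ S3≡) = prevFactor-suffix A (S3 D) phrase∈A (A≤ (length P)) 0<phrase (trans drop≡ (cong (prime P ++_) S3≡))
      by-cases (inj₂ (b , V , b-bin , S3≡)) =
        prevFactor-fresh A (S3 D) phrase∈A (A≤ (length P)) 0<phrase
          (trans drop≡ (trans (cong (prime P ++_) S3≡) (sym (++-assoc (prime P) (nf ∷ []) (b ∷ V)))))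
          (subst (λ Z → AbsentBefore Z S (length P + y₀ pre)) (sym (++-assoc (prime P) (nf ∷ []) (b ∷ [])))
            (window-absent (window-next P-pat (nextFirst-binary rest-pat) b-bin) sp P refl (≤-reflexive (proj₁ P-pat))))

  module Counting (L : ℕ → ℕ) (L-prev : ∀ {y ℓ} → PrevFactor S y ℓ → L y ≡ ℓ) where

    N : ℕ → ℕ
    N = phrases L (length S)

    private
      0<n : 0 < n
      0<n = <-trans z<s 1<n

      ≤2m : k ≤ m → k ≤ m + m
      ≤2m k≤m = ≤-trans k≤m (m≤m+n m m)

      two-suc : ∀ r → 2 * suc r ≡ suc (suc (2 * r))
      two-suc = solve-∀

      hop : ∀ {y ℓ y′} → PrevFactor S y ℓ → 0 < ℓ → y < length S → y + ℓ ≡ y′ → N y ≡ suc (N y′)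
      hop pf 0<ℓ y< y+ℓ≡ = trans (phrases-hop 0<ℓ (L-prev pf) y<) (cong (suc ∘ N) y+ℓ≡)

      D≡snoc : ∀ pre {P} rest → D ≡ pre ++ P ∷ rest → D ≡ (pre ++ P ∷ []) ++ rest
      D≡snoc pre rest D≡ = trans D≡ (sym (++-assoc pre _ rest))

    step-shifted : ∀ {pre p ps rest} → Split pre (p ∷ ps) rest → N (suc (y₀ pre)) ≡ suc (N (m + y₀ pre))
    step-shifted {pre} sp =
      hop (AtBlock.prevFactor-shifted sp) 0<n (within-block sp (≤2m (<⇒≤ 1<m))) (cong suc (+-comm (y₀ pre) n))

    step-occurs : ∀ {pre p ps rest} → Split pre (p ∷ ps) rest → Occurs (p ∷ ps) T → N (y₀ pre) ≡ suc (N (m + y₀ pre))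
    step-occurs {pre} sp P∈T = hop (AtBlock.prevFactor-occurs sp P∈T) z<s (within-block sp z≤n) (+-comm (y₀ pre) m)

    step-next : ∀ {pre p ps rest} → Split pre (p ∷ ps) rest → N (m + y₀ pre) ≡ suc (N (suc (y₀ (pre ++ (p ∷ ps) ∷ []))))
    step-next {pre} sp = hop (AtBlock.prevFactor-next sp) z<s (within-block sp (≤2m ≤-refl))
      (trans (arith m (y₀ pre)) (cong suc (sym (y₀-snoc pre (Split.P-pat sp)))))
      where
      arith : ∀ m y → m + y + suc m ≡ suc (m + m + y)
      arith = solve-∀

    step-absent : ∀ {pre p ps rest} → Split pre (p ∷ ps) rest → ¬ Occurs (p ∷ ps) T →
                  N (y₀ pre) ≡ suc (suc (N (y₀ (pre ++ (p ∷ ps) ∷ []))))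
    step-absent {pre} sp P∉T = trans (hop (AtBlock.prevFactor-absent sp P∉T) 0<n (within-block sp z≤n) (+-comm (y₀ pre) n))
      (cong suc (hop (AtBlock.prevFactor-last sp) z<s (within-block sp (≤2m (n≤1+n n)))
        (trans (arith n (y₀ pre)) (sym (y₀-snoc pre (Split.P-pat sp))))))
      where
      arith : ∀ n y → n + y + suc (suc n) ≡ suc n + suc n + y
      arith = solve-∀

    shifted : ∀ pre rest → D ≡ pre ++ rest → N (suc (y₀ pre)) ≡ 2 * length rest
    shifted pre [] D≡ = phrases-end (≤-reflexive (length-S pre [] D≡))
    shifted pre ([] ∷ rest) D≡ = contradiction (split pre D≡) no-empty-pattern
    shifted pre ((p ∷ ps) ∷ rest) D≡ = begin
      N (suc (y₀ pre))                                ≡⟨ step-shifted sp ⟩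
      suc (N (m + y₀ pre))                            ≡⟨ cong suc (step-next sp) ⟩
      suc (suc (N (suc (y₀ (pre ++ (p ∷ ps) ∷ [])))))  ≡⟨ cong (suc ∘ suc) (shifted _ rest (D≡snoc pre rest D≡)) ⟩
      suc (suc (2 * length rest))                     ≡⟨ two-suc (length rest) ⟨
      2 * length ((p ∷ ps) ∷ rest)                    ∎
      where
      open ≡-Reasoning
      sp = split pre D≡

    aligned-absent : ∀ pre rest → D ≡ pre ++ rest → ¬ Any (λ P → Occurs P T) rest → N (y₀ pre) ≡ suc (2 * length rest)
    aligned-absent pre [] D≡ _ = phrases-last (length-S pre [] D≡)
    aligned-absent pre ([] ∷ rest) D≡ _ = contradiction (split pre D≡) no-empty-pattern
    aligned-absent pre ((p ∷ ps) ∷ rest) D≡ none = begin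
      N (y₀ pre)                                 ≡⟨ step-absent (split pre D≡) (none ∘ here) ⟩
      suc (suc (N (y₀ (pre ++ (p ∷ ps) ∷ []))))  ≡⟨ cong (suc ∘ suc)
                                                      (aligned-absent _ rest (D≡snoc pre rest D≡) (none ∘ there)) ⟩
      suc (suc (suc (2 * length rest)))          ≡⟨ cong suc (two-suc (length rest)) ⟨
      suc (2 * length ((p ∷ ps) ∷ rest))         ∎
      where open ≡-Reasoning

    -- Whether P occurs in T is not decided here; the goal is an equation between numbers,
    -- so it is stable under double negation and we may split on it classically.
    aligned-present : ∀ pre rest → D ≡ pre ++ rest → Any (λ P → Occurs P T) rest → N (y₀ pre) ≡ 2 * length rest
    aligned-present pre ([] ∷ rest) D≡ _ = contradiction (split pre D≡) no-empty-pattern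
    aligned-present pre ((p ∷ ps) ∷ rest) D≡ some =
      decidable-stable (N (y₀ pre) ≟ 2 * length ((p ∷ ps) ∷ rest)) (λ ≢ → ¬¬-excluded-middle (≢ ∘ by-cases))
      where
      open ≡-Reasoning
      sp = split pre D≡
      by-cases : Dec (Occurs (p ∷ ps) T) → N (y₀ pre) ≡ 2 * length ((p ∷ ps) ∷ rest)
      by-cases (yes P∈T) = begin
        N (y₀ pre)                                      ≡⟨ step-occurs sp P∈T ⟩
        suc (N (m + y₀ pre))                            ≡⟨ cong suc (step-next sp) ⟩
        suc (suc (N (suc (y₀ (pre ++ (p ∷ ps) ∷ [])))))  ≡⟨ cong (suc ∘ suc) (shifted _ rest (D≡snoc pre rest D≡)) ⟩
        suc (suc (2 * length rest))                     ≡⟨ two-suc (length rest) ⟨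
        2 * length ((p ∷ ps) ∷ rest)                    ∎
      by-cases (no P∉T) = begin
        N (y₀ pre)                                      ≡⟨ step-absent sp P∉T ⟩
        suc (suc (N (y₀ (pre ++ (p ∷ ps) ∷ []))))       ≡⟨ cong (suc ∘ suc)
                                                           (aligned-present _ rest (D≡snoc pre rest D≡) (later some)) ⟩
        suc (suc (2 * length rest))                     ≡⟨ two-suc (length rest) ⟨
        2 * length ((p ∷ ps) ∷ rest)                    ∎
        where
        later : Any (λ P → Occurs P T) ((p ∷ ps) ∷ rest) → Any (λ P → Occurs P T) rest
        later (here P∈T) = contradiction P∈T P∉T
        later (there some′) = some′

  S2body-<6 : ∀ {E} → All (Pattern m) E → All (_< 6) (S2body E)
  S2body-<6 [] = []
  S2body-<6 {Q ∷ E} ((_ , Q-bin) ∷ E-pat) =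
    ++⁺ (All.map <6 (tailD-All Q-bin)) (4<6 ∷ ++⁺ (All.map <6 (initD-All Q-bin)) (4<6 ∷ <6 (lastD-binary Q-bin) ∷
      ++⁺ prime<6 (4<6 ∷ ++⁺ prime<6 (<6 (nextFirst-binary E-pat) ∷ 4<6 ∷ S2body-<6 E-pat))))
    where
    4<6 : 4 < 6
    4<6 = m<n+m 4 {2} z<s
    <6 : Binary x → x < 6
    <6 b = <-trans (binary<4 b) 4<6
    prime<6 : All (_< 6) (prime Q)
    prime<6 = All.map (λ p → <-trans (proj₂ p) 4<6) (prime-Primed Q-bin)

  private
    A₀ : List ℕ
    A₀ = T ++ 5 ∷ S2body D
    A₀<6 : All (_< 6) A₀
    A₀<6 = ++⁺ (All.map (λ b → <-trans b (m<n+m 2 {4} z<s)) T-bin) (m<n+m 5 {1} z<s ∷ S2body-<6 D-pat)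
    A≡ : A₀ ++ 6 ∷ [] ≡ A
    A≡ = trans (++-assoc T _ _) (sym (++-assoc T _ _))
    S≡ : A₀ ++ 6 ∷ S3 D ≡ S
    S≡ = trans (sym (++-assoc A₀ (6 ∷ []) (S3 D))) (cong (_++ S3 D) A≡)

  z-S : z S ≡ z A + phrases (LPF S) (length S) (length A)
  z-S = subst₂ (λ S′ A′ → z S′ ≡ z A′ + phrases (LPF S′) (length S′) (length A′)) S≡ A≡
               (Separated.z-separated A₀<6 (S3 D))

  zno-S : zno S ≡ zno A + phrases (LPnF S) (length S) (length A)
  zno-S = subst₂ (λ S′ A′ → zno S′ ≡ zno A′ + phrases (LPnF S′) (length S′) (length A′)) S≡ A≡
                 (Separated.zno-separated A₀<6 (S3 D))

  factorizations : ∀ {k} →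
    (∀ L → (∀ {y ℓ} → PrevFactor S y ℓ → L y ≡ ℓ) → phrases L (length S) (length A) ≡ k) →
    z (S1 T ++ S2 D ++ S3 D) ≡ z A + k × zno (S1 T ++ S2 D ++ S3 D) ≡ zno A + k
  factorizations count =
      subst (λ X → z X ≡ z A + _) (++-assoc (S1 T) (S2 D) (S3 D)) (trans z-S (cong (z A +_) (count (LPF S) proj₁)))
    , subst (λ X → zno X ≡ zno A + _) (++-assoc (S1 T) (S2 D) (S3 D)) (trans zno-S (cong (zno A +_) (count (LPnF S) proj₂)))

mainTheorem10 : (T : List ℕ) (m : ℕ) (D : List (List ℕ)) →
    T ≢ [] → All (_< 2) T →
    3 ≤ m → All (λ P → length P ≡ m × All (_< 2) P) D → Unique D →
    (Any (λ P → Occurs P T) D →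
      (z (S1 T ++ S2 D ++ S3 D) ≡ z (S1 T ++ S2 D) + 2 * length D)
      × (zno (S1 T ++ S2 D ++ S3 D) ≡ zno (S1 T ++ S2 D) + 2 * length D))
    × (¬ Any (λ P → Occurs P T) D →
      (z (S1 T ++ S2 D ++ S3 D) ≡ z (S1 T ++ S2 D) + suc (2 * length D))
      × (zno (S1 T ++ S2 D ++ S3 D) ≡ zno (S1 T ++ S2 D) + suc (2 * length D)))
mainTheorem10 T (suc n) D _ T-bin (s≤s 1<n) D-pat D-unique =
    (λ some → factorizations (λ L L-prev → Counting.aligned-present L L-prev [] D refl some))
  , (λ none → factorizations (λ L L-prev → Counting.aligned-absent L L-prev [] D refl none))
  where open Reduction T n 1<n D T-bin D-pat D-unique
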